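{- Let $D$ be a finite core digraph without non-trivial automorphisms, such that the almost-sure theory of the class of finite $D$-coloured digraphs equals the first-order theory of $C_D$. Consider a digraph chosen uniformly at random from the digraphs in $\mathrm{Csp}(D)$ with vertex set $\{1,\dots,n\}$. Then, asymptotically almost surely, it has exactly one homomorphism to $D$.
   Context: A finite digraph is a core if every endomorphism is an automorphism. $\mathrm{Csp}(D)$ is the class of finite digraphs with a homomorphism to $D$. A $D$-coloured digraph is a digraph with unary predicates $P_u$ ($u\in V(D)$), each vertex in exactly one $P_u$, such that the colour map is a homomorphism to $D$. Its almost-sure theory is the set of first-order sentences in signature $\{E\}\cup\{P_u\}$ whose fraction of satisfying $D$-coloured digraphs on $\{1,\dots,n\}$ tends to $1$. $C_D$ is the unique countable homogeneous $D$-coloured digraph whose finite substructures are exactly the finite $D$-coloured digraphs. -}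

module Defs where

open import Data.Nat using (ℕ; zero; suc; _*_; _∸_; _≤_; _<ᵇ_; _≡ᵇ_)
open import Data.Fin using (Fin; toℕ)
open import Data.Bool using (Bool; true; false; not; _∧_; _∨_)
open import Data.List using (List; []; _∷_; map; concatMap; length; filterᵇ; allFin)
open import Data.Bool.ListAction using (all; any)
open import Data.Product using (Σ; _×_; _,_; ∃-syntax)
open import Data.Sum using (_⊎_)
open import Data.Empty using (⊥)
open import Relation.Nullary using (¬_)
open import Relation.Binary.PropositionalEquality using (_≡_)
import Data.Vec.Functional as VF

-- Finite digraphs on vertex set Fin n (edge relation as a Boolean
-- matrix; loops allowed: a digraph is an arbitrary binary relation).

Digraph : ℕ → Set
Digraph n = Fin n → Fin n → Bool

IsHom : ∀ {n m} → Digraph n → Digraph m → (Fin n → Fin m) → Set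
IsHom G H f = ∀ x y → G x y ≡ true → H (f x) (f y) ≡ true

IsAut : ∀ {m} → Digraph m → (Fin m → Fin m) → Set
IsAut D f = IsHom D D f × Σ (_ → _) λ g →
  IsHom D D g × (∀ x → g (f x) ≡ x) × (∀ x → f (g x) ≡ x)

IsCore : ∀ {m} → Digraph m → Set
IsCore D = ∀ f → IsHom D D f → IsAut D f

IsRigid : ∀ {m} → Digraph m → Set
IsRigid D = ∀ f → IsAut D f → ∀ x → f x ≡ x

allFuns : ∀ {A : Set} (n : ℕ) → List A → List (Fin n → A)
allFuns zero xs = (λ ()) ∷ []
allFuns (suc n) xs = concatMap (λ a → map (λ f → a VF.∷ f) (allFuns n xs)) xs

countᵇ : ∀ {A : Set} → (A → Bool) → List A → ℕ
countᵇ p xs = length (filterᵇ p xs)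

allDigraphs : (n : ℕ) → List (Digraph n)
allDigraphs n = allFuns n (allFuns n (true ∷ false ∷ []))

isHomᵇ : ∀ {n m} → Digraph n → Digraph m → (Fin n → Fin m) → Bool
isHomᵇ {n} G H f =
  all (λ x → all (λ y → not (G x y) ∨ H (f x) (f y)) (allFin n)) (allFin n)

homCount : ∀ {n m} → Digraph n → Digraph m → ℕ
homCount {n} {m} G D = countᵇ (isHomᵇ G D) (allFuns n (allFin m))

cspCount : ∀ {m} → Digraph m → ℕ → ℕ
cspCount D n = countᵇ (λ G → 0 <ᵇ homCount G D) (allDigraphs n)

uniqueHomCount : ∀ {m} → Digraph m → ℕ → ℕ
uniqueHomCount D n = countᵇ (λ G → homCount G D ≡ᵇ 1) (allDigraphs n)

-- "good n / total n → 1" (good n ≤ total n in our uses), stated as: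
-- for every k, eventually 1 - good/total ≤ 1/k.
TendsToOne : (good total : ℕ → ℕ) → Set
TendsToOne good total =
  ∀ k → ∃[ N ] ∀ n → N ≤ n → k * (total n ∸ good n) ≤ total n

-- First-order formulas in the signature {E} ∪ {P_u | u ∈ Fin m},
-- with de Bruijn-indexed variables (k free variables).

data Formula (m : ℕ) : ℕ → Set where
  _≐_  : ∀ {k} → Fin k → Fin k → Formula m k
  edge : ∀ {k} → Fin k → Fin k → Formula m k
  P    : ∀ {k} → Fin m → Fin k → Formula m k
  ¬f   : ∀ {k} → Formula m k → Formula m k
  _∧f_ : ∀ {k} → Formula m k → Formula m k → Formula m k
  _∨f_ : ∀ {k} → Formula m k → Formula m k → Formula m k
  ∃f   : ∀ {k} → Formula m (suc k) → Formula m k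
  ∀f   : ∀ {k} → Formula m (suc k) → Formula m k

Sentence : ℕ → Set
Sentence m = Formula m 0

evalFin : ∀ {m n k} → Digraph n → (Fin n → Fin m) → Formula m k → (Fin k → Fin n) → Bool
evalFin G c (i ≐ j) ρ = toℕ (ρ i) ≡ᵇ toℕ (ρ j)
evalFin G c (edge i j) ρ = G (ρ i) (ρ j)
evalFin G c (P u i) ρ = toℕ (c (ρ i)) ≡ᵇ toℕ u
evalFin G c (¬f φ) ρ = not (evalFin G c φ ρ)
evalFin G c (φ ∧f ψ) ρ = evalFin G c φ ρ ∧ evalFin G c ψ ρ
evalFin G c (φ ∨f ψ) ρ = evalFin G c φ ρ ∨ evalFin G c ψ ρ
evalFin {n = n} G c (∃f φ) ρ = any (λ a → evalFin G c φ (a VF.∷ ρ)) (allFin n)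
evalFin {n = n} G c (∀f φ) ρ = all (λ a → evalFin G c φ (a VF.∷ ρ)) (allFin n)

emptyEnv : ∀ {A : Set} → Fin 0 → A
emptyEnv ()

allDColoured : ∀ {m} → Digraph m → (n : ℕ) → List (Digraph n × (Fin n → Fin m))
allDColoured {m} D n =
  filterᵇ (λ { (G , c) → isHomᵇ G D c })
    (concatMap (λ G → map (λ c → G , c) (allFuns n (allFin m))) (allDigraphs n))

dColCount : ∀ {m} → Digraph m → ℕ → ℕ
dColCount D n = length (allDColoured D n)

satCount : ∀ {m} → Digraph m → Sentence m → ℕ → ℕ
satCount D φ n = countᵇ (λ { (G , c) → evalFin G c φ emptyEnv }) (allDColoured D n)

AlmostSure : ∀ {m} → Digraph m → Sentence m → Set
AlmostSure D φ = TendsToOne (satCount D φ) (dColCount D)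

record DStructure {m : ℕ} (D : Digraph m) : Set₁ where
  field
    V          : Set
    code       : V → ℕ                       -- countability
    code-inj   : ∀ x y → code x ≡ code y → x ≡ y
    E          : V → V → Bool
    colour     : V → Fin m                   -- x ∈ P_u  iff  colour x ≡ u
    colour-hom : ∀ x y → E x y ≡ true → D (colour x) (colour y) ≡ true

module _ {m : ℕ} {D : Digraph m} (C : DStructure D) where
  open DStructure C

  -- classical (Tarskian) satisfaction, rendered via the double-negation
  -- translation so that it agrees with classical truth
  Sat : ∀ {k} → Formula m k → (Fin k → V) → Set
  Sat (i ≐ j) ρ = ρ i ≡ ρ j
  Sat (edge i j) ρ = E (ρ i) (ρ j) ≡ true
  Sat (P u i) ρ = colour (ρ i) ≡ u
  Sat (¬f φ) ρ = ¬ Sat φ ρ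
  Sat (φ ∧f ψ) ρ = Sat φ ρ × Sat ψ ρ
  Sat (φ ∨f ψ) ρ = ¬ ¬ (Sat φ ρ ⊎ Sat ψ ρ)
  Sat (∃f φ) ρ = ¬ ¬ (Σ V λ a → Sat φ (a VF.∷ ρ))
  Sat (∀f φ) ρ = ∀ a → Sat φ (a VF.∷ ρ)

  InjectiveTuple : ∀ {k} → (Fin k → V) → Set
  InjectiveTuple a = ∀ i j → a i ≡ a j → i ≡ j

  IsAutomorphism : (V → V) → Set
  IsAutomorphism σ = Σ (V → V) λ τ →
    (∀ x → τ (σ x) ≡ x) × (∀ x → σ (τ x) ≡ x) ×
    (∀ x y → E (σ x) (σ y) ≡ E x y) × (∀ x → colour (σ x) ≡ colour x)

  -- every isomorphism between finite substructures (given as the map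
  -- a i ↦ b i between injective tuples) extends to an automorphism
  IsHomogeneous : Set
  IsHomogeneous = ∀ k (a b : Fin k → V) → InjectiveTuple a → InjectiveTuple b →
    (∀ i j → E (a i) (a j) ≡ E (b i) (b j)) → (∀ i → colour (a i) ≡ colour (b i)) →
    Σ (V → V) λ σ → IsAutomorphism σ × (∀ i → σ (a i) ≡ b i)

  -- every finite D-coloured digraph embeds as an induced substructure
  -- (together with colour-hom: the age is exactly the finite D-coloured digraphs)
  AgeContainsAll : Set
  AgeContainsAll = ∀ n (G : Digraph n) (c : Fin n → Fin m) → IsHom G D c →
    Σ (Fin n → V) λ f → InjectiveTuple f ×
      (∀ i j → E (f i) (f j) ≡ G i j) × (∀ i → colour (f i) ≡ c i)

  IsCD : Set
  IsCD = IsHomogeneous × AgeContainsAll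

-- Let φ_D say that every vertex x, of colour u say, is the image of u under some homomorphism
-- σ : D → G, unless u carries a loop (a core with a loop has a single vertex). C_D satisfies φ_D,
-- since homogeneity moves a copy of D inside C_D onto any vertex of the right colour; so φ_D holds
-- in almost all D-coloured digraphs. If (G, c) ⊨ φ_D and h : G → D, then h ∘ σ is an endomorphism
-- of the rigid core D, so h x = h (σ u) = u = c x, and c is the only homomorphism G → D.
-- Counting per graph: a graph with two homomorphisms carries only colourings violating φ_D, so
-- #Csp − #unique ≤ #violating colourings, while #Csp ≥ #satisfying colourings.

module Submission where

open import Defs
open import Data.Nat using (ℕ; zero; suc; _+_; _*_; _∸_; _≤_; _<_; _≡ᵇ_; _<ᵇ_; z≤n; s≤s)
open import Data.Nat.Properties
  using ( ≡ᵇ⇒≡; ≡⇒≡ᵇ; +-comm; +-assoc; +-suc; +-commutativeSemigroup; +-mono-≤; +-monoʳ-≤; *-monoʳ-≤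
        ; +-cancelˡ-≤; +-cancelʳ-≤; m≤n+m; m≤n⇒m≤1+n; m≤n+o⇒m∸n≤o; m∸n+n≡m; m+[n∸m]≡n; module ≤-Reasoning)
open import Algebra.Properties.CommutativeSemigroup +-commutativeSemigroup using (x∙yz≈y∙xz)
open import Data.Nat.ListAction using (sum)
open import Data.Fin using (Fin; zero; suc; toℕ; _↑ˡ_; _↑ʳ_; _≟_)
open import Data.Fin.Properties using (toℕ-injective)
open import Data.Bool using (Bool; true; false; T; T?; not; _∧_; _∨_; if_then_else_)
open import Data.Bool.Properties using (T-≡; ⇔→≡; ∧-conicalˡ; ∧-conicalʳ)
open import Data.Bool.ListAction using (all; any)
open import Data.List using (List; []; _∷_; _++_; map; concatMap; filterᵇ; length; allFin; tabulate)
open import Data.List.Properties using (map-cong; map-tabulate; filter-≐; length-filter)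
open import Data.List.Membership.Propositional.Properties using (∈-allFin)
import Data.List.Relation.Unary.All as All
open import Data.List.Relation.Unary.All.Properties using (all⁺; all⁻)
open import Data.List.Relation.Unary.Any using (satisfied)
open import Data.List.Relation.Unary.Any.Properties using (any⁻)
import Data.Vec.Functional as V
open import Data.Vec.Functional.Properties using (lookup-++ˡ; lookup-++ʳ)
open import Data.Product using (_×_; _,_; proj₂; ∃-syntax)
import Data.Product as Product
open import Data.Sum using (_⊎_; inj₁; inj₂)
import Data.Sum as Sum
open import Function using (_∘_; id; mk⇔; Equivalence)
open import Relation.Binary.PropositionalEquality
  using (_≡_; _≗_; refl; sym; trans; cong; cong₂; subst; subst₂; module ≡-Reasoning)

open import Relation.Nullary using (yes; no)

open Equivalence using (to; from)

module _ {A : Set} (p : A → Bool) where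

  countᵇ-++ : ∀ xs ys → countᵇ p (xs ++ ys) ≡ countᵇ p xs + countᵇ p ys
  countᵇ-++ [] ys = refl
  countᵇ-++ (x ∷ xs) ys with p x
  ... | true  = cong suc (countᵇ-++ xs ys)
  ... | false = countᵇ-++ xs ys

  countᵇ-concatMap : ∀ {B : Set} (f : B → List A) xs →
    countᵇ p (concatMap f xs) ≡ sum (map (countᵇ p ∘ f) xs)
  countᵇ-concatMap f [] = refl
  countᵇ-concatMap f (x ∷ xs) =
    trans (countᵇ-++ (f x) (concatMap f xs)) (cong (countᵇ p (f x) +_) (countᵇ-concatMap f xs))

  countᵇ-map : ∀ {B : Set} (f : B → A) xs → countᵇ p (map f xs) ≡ countᵇ (p ∘ f) xs
  countᵇ-map f [] = refl
  countᵇ-map f (x ∷ xs) with p (f x)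
  ... | true  = cong suc (countᵇ-map f xs)
  ... | false = countᵇ-map f xs

  countᵇ-filterᵇ : ∀ (q : A → Bool) xs → countᵇ p (filterᵇ q xs) ≡ countᵇ (λ x → q x ∧ p x) xs
  countᵇ-filterᵇ q [] = refl
  countᵇ-filterᵇ q (x ∷ xs) with q x
  ... | false = countᵇ-filterᵇ q xs
  ... | true with p x
  ...   | true  = cong suc (countᵇ-filterᵇ q xs)
  ...   | false = countᵇ-filterᵇ q xs

  countᵇ-pos : ∀ xs → 0 < countᵇ p xs → ∃[ x ] p x ≡ true
  countᵇ-pos (x ∷ xs) pos with p x in px
  ... | true  = x , px
  ... | false = countᵇ-pos xs pos

  any-witness : ∀ xs → any p xs ≡ true → ∃[ x ] p x ≡ true
  any-witness xs e = Product.map₂ (to T-≡) (satisfied (any⁻ p xs (from T-≡ e)))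

countᵇ-cong : ∀ {A : Set} {p q : A → Bool} → p ≗ q → countᵇ p ≗ countᵇ q
countᵇ-cong {p = p} {q} p≗q xs =
  cong length (filter-≐ (T? ∘ p) (T? ∘ q) ((λ {x} → subst T (p≗q x)) , (λ {x} → subst T (sym (p≗q x)))) xs)

countᵇ-false : ∀ {A : Set} (xs : List A) → countᵇ (λ _ → false) xs ≡ 0
countᵇ-false [] = refl
countᵇ-false (x ∷ xs) = countᵇ-false xs

module _ {n} (p : Fin n → Bool) where

  all-allFin⁻ : all p (allFin n) ≡ true → ∀ x → p x ≡ true
  all-allFin⁻ e x = to T-≡ (All.lookup (all⁺ p (allFin n) (from T-≡ e)) (∈-allFin x))

  all-allFin⁺ : (∀ x → p x ≡ true) → all p (allFin n) ≡ true
  all-allFin⁺ h = to T-≡ (all⁻ p {xs = allFin n} (All.tabulate (λ {x} _ → from T-≡ (h x))))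

toℕ-≡ᵇ⇒≡ : ∀ {m} {a b : Fin m} → (toℕ a ≡ᵇ toℕ b) ≡ true → a ≡ b
toℕ-≡ᵇ⇒≡ {a = a} {b} e = toℕ-injective (≡ᵇ⇒≡ (toℕ a) (toℕ b) (from T-≡ e))

toℕ-≡ᵇ-refl : ∀ {m} (a : Fin m) → (toℕ a ≡ᵇ toℕ a) ≡ true
toℕ-≡ᵇ-refl a = to T-≡ (≡⇒≡ᵇ (toℕ a) (toℕ a) refl)

countᵇ-allFin-suc : ∀ {m} (p : Fin (suc m) → Bool) →
  countᵇ p (allFin (suc m)) ≡ countᵇ p (zero ∷ []) + countᵇ (p ∘ suc) (allFin m)
countᵇ-allFin-suc {m} p = trans (countᵇ-++ p (zero ∷ []) (tabulate suc))
  (cong (countᵇ p (zero ∷ []) +_)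
    (trans (cong (countᵇ p) (sym (map-tabulate id suc))) (countᵇ-map p suc (allFin m))))

countᵇ-allFin-≡ᵇ : ∀ {m} (b : Fin m) → countᵇ (λ a → toℕ a ≡ᵇ toℕ b) (allFin m) ≡ 1
countᵇ-allFin-≡ᵇ {suc m} zero =
  trans (countᵇ-allFin-suc {m} (λ a → toℕ a ≡ᵇ 0)) (cong suc (countᵇ-false (allFin m)))
countᵇ-allFin-≡ᵇ {suc m} (suc b) =
  trans (countᵇ-allFin-suc {m} (λ a → toℕ a ≡ᵇ suc (toℕ b))) (countᵇ-allFin-≡ᵇ b)

infix 5 _≗ᵇ_

_≗ᵇ_ : ∀ {n m} → (Fin n → Fin m) → (Fin n → Fin m) → Bool
_≗ᵇ_ {zero}  g f = true
_≗ᵇ_ {suc n} g f = (toℕ (g zero) ≡ᵇ toℕ (f zero)) ∧ (g ∘ suc ≗ᵇ f ∘ suc)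

≗ᵇ⇒≗ : ∀ {n m} {g f : Fin n → Fin m} → g ≗ᵇ f ≡ true → g ≗ f
≗ᵇ⇒≗ {suc n} {g = g} e zero    = toℕ-≡ᵇ⇒≡ (∧-conicalˡ _ (g ∘ suc ≗ᵇ _) e)
≗ᵇ⇒≗ {suc n} {g = g} e (suc i) = ≗ᵇ⇒≗ (∧-conicalʳ (toℕ (g zero) ≡ᵇ _) _ e) i

≗⇒≗ᵇ : ∀ {n m} {g f : Fin n → Fin m} → g ≗ f → g ≗ᵇ f ≡ true
≗⇒≗ᵇ {zero}              g≗f = refl
≗⇒≗ᵇ {suc n} {f = f} g≗f rewrite g≗f zero | toℕ-≡ᵇ-refl (f zero) = ≗⇒≗ᵇ (g≗f ∘ suc)

module _ {A : Set} {n} (t : A → Bool) (q : (Fin n → A) → Bool) (gs : List (Fin n → A)) where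

  countᵇ-cons-product : ∀ xs →
    countᵇ (λ g → t (g zero) ∧ q (g ∘ suc)) (concatMap (λ x → map (x V.∷_) gs) xs) ≡ countᵇ t xs * countᵇ q gs
  countᵇ-cons-product [] = refl
  countᵇ-cons-product (x ∷ xs) =
    trans (countᵇ-++ _ (map (x V.∷_) gs) _)
      (trans (cong₂ _+_ (countᵇ-map _ (x V.∷_) gs) (countᵇ-cons-product xs)) x-block)
    where
    x-block : countᵇ (λ g → t x ∧ q g) gs + countᵇ t xs * countᵇ q gs ≡ countᵇ t (x ∷ xs) * countᵇ q gs
    x-block with t x
    ... | true  = refl
    ... | false = cong (_+ countᵇ t xs * countᵇ q gs) (countᵇ-false gs)

countᵇ-allFuns-≗ᵇ : ∀ {m} n (f : Fin n → Fin m) → countᵇ (_≗ᵇ f) (allFuns n (allFin m)) ≡ 1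
countᵇ-allFuns-≗ᵇ zero    f = refl
countᵇ-allFuns-≗ᵇ {m} (suc n) f = begin
  countᵇ (_≗ᵇ f) (allFuns (suc n) (allFin m))
    ≡⟨ countᵇ-cons-product (λ a → toℕ a ≡ᵇ toℕ (f zero)) (_≗ᵇ f ∘ suc) (allFuns n (allFin m)) (allFin m) ⟩
  countᵇ (λ a → toℕ a ≡ᵇ toℕ (f zero)) (allFin m) * countᵇ (_≗ᵇ f ∘ suc) (allFuns n (allFin m))
    ≡⟨ cong₂ _*_ (countᵇ-allFin-≡ᵇ (f zero)) (countᵇ-allFuns-≗ᵇ n (f ∘ suc)) ⟩
  1 ∎
  where open ≡-Reasoning

module _ {n m} (G : Digraph n) (H : Digraph m) where

  isHomᵇ⇒IsHom : ∀ {f} → isHomᵇ G H f ≡ true → IsHom G H f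
  isHomᵇ⇒IsHom e x y Gxy with all-allFin⁻ _ (all-allFin⁻ _ e x) y
  ... | edge-ok rewrite Gxy = edge-ok

  IsHom⇒isHomᵇ : ∀ {f} → IsHom G H f → isHomᵇ G H f ≡ true
  IsHom⇒isHomᵇ {f} hom = all-allFin⁺ _ λ x → all-allFin⁺ _ λ y → edge-ok x y
    where
    edge-ok : ∀ x y → not (G x y) ∨ H (f x) (f y) ≡ true
    edge-ok x y with G x y in Gxy
    ... | true  = hom x y Gxy
    ... | false = refl

  IsHom-resp-≗ : ∀ {f g} → f ≗ g → IsHom G H f → IsHom G H g
  IsHom-resp-≗ f≗g hom x y Gxy = subst₂ (λ a b → H a b ≡ true) (f≗g x) (f≗g y) (hom x y Gxy)

  homCount≡1 : ∀ {c} → IsHom G H c → (∀ h → IsHom G H h → h ≗ c) → homCount G H ≡ 1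
  homCount≡1 {c} hom unique =
    trans (countᵇ-cong (λ g → ⇔→≡ (mk⇔ (≗⇒≗ᵇ ∘ unique g ∘ isHomᵇ⇒IsHom) (IsHom⇒isHomᵇ ∘ same-as-c g)))
                       (allFuns n (allFin m)))
          (countᵇ-allFuns-≗ᵇ n c)
    where
    same-as-c : ∀ g → g ≗ᵇ c ≡ true → IsHom G H g
    same-as-c g g≗c = IsHom-resp-≗ (sym ∘ ≗ᵇ⇒≗ g≗c) hom

⊤f : ∀ {m k} → Formula m k
⊤f = ∀f (zero ≐ zero)

infixr 4 _⇒f_

_⇒f_ : ∀ {m k} → Formula m k → Formula m k → Formula m k
φ ⇒f ψ = ¬f φ ∨f ψ

⋀ : ∀ {m k j} → (Fin j → Formula m k) → Formula m k
⋀ {j = zero}  φs = ⊤f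
⋀ {j = suc j} φs = φs zero ∧f ⋀ (φs ∘ suc)

∃ⁿ : ∀ {m k} j → Formula m (j + k) → Formula m k
∃ⁿ zero    φ = φ
∃ⁿ (suc j) φ = ∃ⁿ j (∃f φ)

module _ {m n} (G : Digraph n) (c : Fin n → Fin m) where

  evalFin-⋀ : ∀ {k j} (φs : Fin j → Formula m k) {ρ} → evalFin G c (⋀ φs) ρ ≡ true → ∀ i → evalFin G c (φs i) ρ ≡ true
  evalFin-⋀ φs {ρ} e zero    = ∧-conicalˡ _ (evalFin G c (⋀ (φs ∘ suc)) ρ) e
  evalFin-⋀ φs {ρ} e (suc i) = evalFin-⋀ (φs ∘ suc) (∧-conicalʳ (evalFin G c (φs zero) ρ) _ e) i

  evalFin-∃ⁿ : ∀ {k} j (φ : Formula m (j + k)) {ρ} → evalFin G c (∃ⁿ j φ) ρ ≡ true →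
    ∃[ τ ] (∀ i → τ (j ↑ʳ i) ≡ ρ i) × evalFin G c φ τ ≡ true
  evalFin-∃ⁿ zero    φ {ρ} e = ρ , (λ _ → refl) , e
  evalFin-∃ⁿ (suc j) φ e with τ , extends , ∃φ[τ] ← evalFin-∃ⁿ j (∃f φ) e
    with a , φ[a∷τ] ← any-witness _ (allFin n) ∃φ[τ] = a V.∷ τ , extends , φ[a∷τ]

module _ {m} {D : Digraph m} (C : DStructure D) where
  open DStructure C

  private
    ∷-cong : ∀ {k} {ρ ρ′ : Fin k → V} a → ρ ≗ ρ′ → (a V.∷ ρ) ≗ (a V.∷ ρ′)
    ∷-cong a e zero    = refl
    ∷-cong a e (suc i) = e i

  Sat-cong : ∀ {k} (φ : Formula m k) {ρ ρ′ : Fin k → V} → ρ ≗ ρ′ → Sat C φ ρ → Sat C φ ρ′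
  Sat-cong (i ≐ j)    e s       = trans (sym (e i)) (trans s (e j))
  Sat-cong (edge i j) e s       = subst₂ (λ a b → E a b ≡ true) (e i) (e j) s
  Sat-cong (P u i)    e s       = trans (cong colour (sym (e i))) s
  Sat-cong (¬f φ)     e s t     = s (Sat-cong φ (sym ∘ e) t)
  Sat-cong (φ ∧f ψ)   e (s , t) = Sat-cong φ e s , Sat-cong ψ e t
  Sat-cong (φ ∨f ψ)   e s k     = s (k ∘ Sum.map (Sat-cong φ e) (Sat-cong ψ e))
  Sat-cong (∃f φ)     e s k     = s (k ∘ Product.map₂ (Sat-cong φ (∷-cong _ e)))
  Sat-cong (∀f φ)     e s a     = Sat-cong φ (∷-cong a e) (s a)

  Sat-⋀ : ∀ {k j} (φs : Fin j → Formula m k) {ρ} → (∀ i → Sat C (φs i) ρ) → Sat C (⋀ φs) ρ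
  Sat-⋀ {j = zero}  φs h = λ _ → refl
  Sat-⋀ {j = suc j} φs h = h zero , Sat-⋀ (φs ∘ suc) (h ∘ suc)

  Sat-∃ⁿ : ∀ {k} j (φ : Formula m (j + k)) {ρ} τ → (∀ i → τ (j ↑ʳ i) ≡ ρ i) → Sat C φ τ → Sat C (∃ⁿ j φ) ρ
  Sat-∃ⁿ zero    φ τ extends s = Sat-cong φ extends s
  Sat-∃ⁿ (suc j) φ τ extends s = Sat-∃ⁿ j (∃f φ) (τ ∘ suc) extends (λ ¬s → ¬s (τ zero , Sat-cong φ head∷tail s))
    where
    head∷tail : τ ≗ (τ zero V.∷ τ ∘ suc)
    head∷tail zero    = refl
    head∷tail (suc i) = refl

-- The sentence φ_D

module _ {m} (D : Digraph m) where

  copyVar : Fin m → Fin (m + 1)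
  copyVar v = v ↑ˡ 1

  rootVar : Fin (m + 1)
  rootVar = m ↑ʳ zero

  copyOf : Formula m (m + 1)
  copyOf = ⋀ λ v → ⋀ λ w → if D v w then edge (copyVar v) (copyVar w) else ⊤f

  rootedCopy : Fin m → Formula m 1
  rootedCopy u = ∃ⁿ m ((copyVar u ≐ rootVar) ∧f copyOf)

  coveredByCopies : Sentence m
  coveredByCopies = ∀f (⋀ λ u → P u zero ⇒f (if D u u then ⊤f else rootedCopy u))

  HomFrom : {V : Set} → (V → V → Bool) → (Fin m → V) → Set
  HomFrom E σ = ∀ v w → D v w ≡ true → E (σ v) (σ w) ≡ true

  Covered : {V : Set} → (V → V → Bool) → (V → Fin m) → Set
  Covered E colour = ∀ x → D (colour x) (colour x) ≡ true ⊎ ∃[ σ ] HomFrom E σ × σ (colour x) ≡ x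

  module _ {n} (G : Digraph n) (c : Fin n → Fin m) where

    evalFin-copyOf : ∀ {τ} → evalFin G c copyOf τ ≡ true → HomFrom G (τ ∘ copyVar)
    evalFin-copyOf e v w Dvw with D v w | Dvw | evalFin-⋀ G c _ (evalFin-⋀ G c _ e v) w
    ... | true | refl | edge-ok = edge-ok

    evalFin-rootedCopy : ∀ u {x} → evalFin G c (rootedCopy u) (x V.∷ emptyEnv) ≡ true → ∃[ σ ] HomFrom G σ × σ u ≡ x
    evalFin-rootedCopy u e with τ , extends , body ← evalFin-∃ⁿ G c m _ e
      = τ ∘ copyVar
      , evalFin-copyOf (∧-conicalʳ _ (evalFin G c copyOf τ) body)
      , trans (toℕ-≡ᵇ⇒≡ (∧-conicalˡ _ (evalFin G c copyOf τ) body)) (extends zero)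

    evalFin-coveredByCopies : evalFin G c coveredByCopies emptyEnv ≡ true → Covered G c
    evalFin-coveredByCopies e x with evalFin-⋀ G c _ (all-allFin⁻ _ e x) (c x)
    ... | clause rewrite toℕ-≡ᵇ-refl (c x) with D (c x) (c x)
    ...   | true  = inj₁ refl
    ...   | false = inj₂ (evalFin-rootedCopy (c x) clause)

  module _ (C : DStructure D) where
    open DStructure C

    Sat-copyOf : ∀ {τ} → HomFrom E (τ ∘ copyVar) → Sat C copyOf τ
    Sat-copyOf hom = Sat-⋀ C _ λ v → Sat-⋀ C _ λ w → edge-ok v w
      where
      edge-ok : ∀ v w → Sat C (if D v w then edge (copyVar v) (copyVar w) else ⊤f) _
      edge-ok v w with D v w in Dvw
      ... | true  = hom v w Dvw
      ... | false = λ _ → refl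

    Sat-rootedCopy : ∀ u {a} σ → HomFrom E σ → σ u ≡ a → Sat C (rootedCopy u) (a V.∷ emptyEnv)
    Sat-rootedCopy u {a} σ hom σu≡a =
      Sat-∃ⁿ C m _ τ (lookup-++ʳ σ (a V.∷ emptyEnv))
        ( trans (lookup-++ˡ σ _ u) (trans σu≡a (sym (lookup-++ʳ σ _ zero)))
        , Sat-copyOf λ v w Dvw → subst₂ (λ a b → E a b ≡ true) (sym (lookup-++ˡ σ _ v)) (sym (lookup-++ˡ σ _ w)) (hom v w Dvw))
      where
      τ = σ V.++ (a V.∷ emptyEnv)

    Sat-coveredByCopies : Covered E colour → Sat C coveredByCopies emptyEnv
    Sat-coveredByCopies covered a = Sat-⋀ C _ clause
      where
      clause : ∀ u → Sat C (P u zero ⇒f (if D u u then ⊤f else rootedCopy u)) (a V.∷ emptyEnv)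
      clause u ¬clause with colour a ≟ u
      ... | no  colour≢u = ¬clause (inj₁ colour≢u)
      ... | yes refl with D (colour a) (colour a) | covered a
      ...   | true  | _                      = ¬clause (inj₂ (λ _ → refl))
      ...   | false | inj₁ ()
      ...   | false | inj₂ (σ , hom , σu≡a) = ¬clause (inj₂ (Sat-rootedCopy (colour a) σ hom σu≡a))

-- Rigid cores and C_D

module _ {m} {D : Digraph m} (core : IsCore D) where

  loop⇒single-vertex : ∀ {u} → D u u ≡ true → ∀ v w → v ≡ w
  loop⇒single-vertex {u} loop v w with _ , g , _ , g∘const≗id , _ ← core (λ _ → u) (λ _ _ _ → loop)
    = trans (sym (g∘const≗id v)) (g∘const≗id w)

  Covered⇒unique-hom : IsRigid D → ∀ {n} {G : Digraph n} {c} → Covered D G c → ∀ h → IsHom G D h → h ≗ c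
  Covered⇒unique-hom rigid {c = c} covered h hom x with covered x
  ... | inj₁ loop = loop⇒single-vertex loop (h x) (c x)
  ... | inj₂ (σ , σ-hom , σcx≡x) = trans (cong h (sym σcx≡x)) (rigid (h ∘ σ) (core (h ∘ σ) h∘σ-hom) (c x))
    where
    h∘σ-hom : IsHom D D (h ∘ σ)
    h∘σ-hom v w Dvw = hom (σ v) (σ w) (σ-hom v w Dvw)

module _ {m} {D : Digraph m} (C : DStructure D) where
  open DStructure C

  loopless : ∀ a → D (colour a) (colour a) ≡ false → E a a ≡ false
  loopless a loop with E a a in Eaa
  ... | true  = trans (sym (colour-hom a a Eaa)) loop
  ... | false = refl

  singleton-injective : ∀ x → InjectiveTuple C (λ (_ : Fin 1) → x)
  singleton-injective x zero zero _ = refl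

  IsCD⇒Covered : IsCD C → Covered D E colour
  IsCD⇒Covered (homogeneous , universal) a with D (colour a) (colour a) in loop
  ... | true  = inj₁ refl
  ... | false with f , _ , f-edges , f-colours ← universal m D id (λ _ _ Dvw → Dvw)
    with σ , (_ , _ , _ , σ-edges , _) , σfu≡a ←
           homogeneous 1 (λ _ → f (colour a)) (λ _ → a) (singleton-injective _) (singleton-injective a)
             (λ _ _ → trans (f-edges _ _) (trans loop (sym (loopless a loop)))) (λ _ → f-colours _)
    = inj₂ (σ ∘ f , σ∘f-hom , σfu≡a zero)
    where
    σ∘f-hom : HomFrom D E (σ ∘ f)
    σ∘f-hom v w Dvw = trans (σ-edges (f v) (f w)) (trans (f-edges v w) Dvw)

private
  single-hom : ∀ {a s u p k} → k ≤ 1 → a + s ≤ u + p → suc a + (k + s) ≤ suc u + (1 + p)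
  single-hom {a} {s} {u} {p} {k} k≤1 ih = s≤s (begin
    a + (k + s) ≡⟨ x∙yz≈y∙xz a k s ⟩
    k + (a + s) ≤⟨ +-mono-≤ k≤1 ih ⟩
    suc (u + p) ≡⟨ sym (+-suc u p) ⟩
    u + suc p   ∎)
    where open ≤-Reasoning

  several-homs : ∀ {a s u p} h → a + s ≤ u + p → suc a + s ≤ u + (suc (suc h) + p)
  several-homs {a} {s} {u} {p} h ih = begin
    suc (a + s)           ≤⟨ s≤s ih ⟩
    suc (u + p)           ≡⟨ sym (+-suc u p) ⟩
    u + suc p             ≤⟨ +-monoʳ-≤ u (s≤s (m≤n+m p (suc h))) ⟩
    u + (suc (suc h) + p) ∎
    where open ≤-Reasoning

module GraphCounts {A : Set} (homs sats : A → ℕ)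
  (sats≤homs : ∀ x → sats x ≤ homs x) (sats>0⇒homs≡1 : ∀ x → 0 < sats x → homs x ≡ 1) where

  sum-≤-count-pos : ∀ xs → sum (map sats xs) ≤ countᵇ (λ x → 0 <ᵇ homs x) xs
  sum-≤-count-pos [] = z≤n
  sum-≤-count-pos (x ∷ xs) with homs x | sats x | sats≤homs x | sats>0⇒homs≡1 x
  ... | 0           | 0     | _    | _   = sum-≤-count-pos xs
  ... | 1           | _     | s≤1  | _   = +-mono-≤ s≤1 (sum-≤-count-pos xs)
  ... | suc (suc _) | 0     | _    | _   = m≤n⇒m≤1+n (sum-≤-count-pos xs)
  ... | suc (suc _) | suc _ | _    | pos with () ← pos (s≤s z≤n)

  count-pos+sum-≤ : ∀ xs →
    countᵇ (λ x → 0 <ᵇ homs x) xs + sum (map sats xs) ≤ countᵇ (λ x → homs x ≡ᵇ 1) xs + sum (map homs xs)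
  count-pos+sum-≤ [] = z≤n
  count-pos+sum-≤ (x ∷ xs) with homs x | sats x | sats≤homs x | sats>0⇒homs≡1 x | count-pos+sum-≤ xs
  ... | 0           | 0     | _   | _   | ih = ih
  ... | 1           | _     | s≤1 | _   | ih = single-hom {countᵇ (λ x → 0 <ᵇ homs x) xs} s≤1 ih
  ... | suc (suc h) | 0     | _   | _   | ih = several-homs {countᵇ (λ x → 0 <ᵇ homs x) xs} h ih
  ... | suc (suc _) | suc _ | _   | pos | _  with () ← pos (s≤s z≤n)

-- The first hypothesis is total′ − good′ ≤ total − good, written without truncated subtraction.
TendsToOne-transfer : ∀ {good total good′ total′ : ℕ → ℕ} →
  (∀ n → total′ n + good n ≤ good′ n + total n) → (∀ n → good n ≤ total′ n) → (∀ n → good n ≤ total n) →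
  TendsToOne good total → TendsToOne good′ total′
TendsToOne-transfer {good} {total} {good′} {total′} excess good≤total′ good≤total lim k
  with N , tail ← lim (suc k) = N , λ n N≤n → bound (excess n) (good≤total′ n) (good≤total n) (tail n N≤n)
  where
  bound : ∀ {a u s p} → a + s ≤ u + p → s ≤ a → s ≤ p → suc k * (p ∸ s) ≤ p → k * (a ∸ u) ≤ a
  bound {a} {u} {s} {p} a+s≤u+p s≤a s≤p lim-bound = begin
    k * (a ∸ u) ≤⟨ *-monoʳ-≤ k (m≤n+o⇒m∸n≤o a u a≤u+d) ⟩
    k * d       ≤⟨ +-cancelˡ-≤ d _ _ kd+d≤s+d ⟩
    s           ≤⟨ s≤a ⟩
    a           ∎
    where
    open ≤-Reasoning
    d = p ∸ s
    a≤u+d : a ≤ u + d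
    a≤u+d = +-cancelʳ-≤ s a (u + d)
      (subst (a + s ≤_) (trans (cong (u +_) (sym (m∸n+n≡m s≤p))) (sym (+-assoc u d s))) a+s≤u+p)
    kd+d≤s+d : d + k * d ≤ d + s
    kd+d≤s+d = subst (d + k * d ≤_) (trans (sym (m+[n∸m]≡n s≤p)) (+-comm s d)) lim-bound

module _ {m} (D : Digraph m) where

  colourings : ∀ n → Digraph n → List (Digraph n × (Fin n → Fin m))
  colourings n G = map (G ,_) (allFuns n (allFin m))

  satColouringCount : ∀ {n} → Sentence m → Digraph n → ℕ
  satColouringCount {n} φ G = countᵇ (λ c → isHomᵇ G D c ∧ evalFin G c φ emptyEnv) (allFuns n (allFin m))

  dColCount≡sum-homCount : ∀ n → dColCount D n ≡ sum (map (λ G → homCount G D) (allDigraphs n))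
  dColCount≡sum-homCount n =
    trans (countᵇ-concatMap _ (colourings n) (allDigraphs n))
      (cong sum (map-cong (λ G → countᵇ-map _ (G ,_) (allFuns n (allFin m))) (allDigraphs n)))

  satCount≡sum-satColouringCount : ∀ φ n → satCount D φ n ≡ sum (map (satColouringCount φ) (allDigraphs n))
  satCount≡sum-satColouringCount φ n =
    trans (countᵇ-filterᵇ _ _ (concatMap (colourings n) (allDigraphs n)))
      (trans (countᵇ-concatMap _ (colourings n) (allDigraphs n))
        (cong sum (map-cong (λ G → countᵇ-map _ (G ,_) (allFuns n (allFin m))) (allDigraphs n))))

  satColouringCount≤homCount : ∀ {n} φ (G : Digraph n) → satColouringCount φ G ≤ homCount G D
  satColouringCount≤homCount {n} φ G =
    subst (_≤ homCount G D) (countᵇ-filterᵇ (λ c → evalFin G c φ emptyEnv) (isHomᵇ G D) (allFuns n (allFin m)))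
      (length-filter (T? ∘ λ c → evalFin G c φ emptyEnv) (filterᵇ (isHomᵇ G D) (allFuns n (allFin m))))

  coveredByCopies⇒homCount≡1 : IsCore D → IsRigid D → ∀ {n} (G : Digraph n) →
    0 < satColouringCount (coveredByCopies D) G → homCount G D ≡ 1
  coveredByCopies⇒homCount≡1 core rigid {n} G pos with c , hom∧covered ← countᵇ-pos _ (allFuns n (allFin m)) pos
    = homCount≡1 G D (isHomᵇ⇒IsHom G D (∧-conicalˡ _ _ hom∧covered))
        (Covered⇒unique-hom core rigid (evalFin-coveredByCopies D G c (∧-conicalʳ _ _ hom∧covered)))

  module _ (core : IsCore D) (rigid : IsRigid D) (n : ℕ) where
    open GraphCounts (λ (G : Digraph n) → homCount G D) (satColouringCount (coveredByCopies D))
      (satColouringCount≤homCount (coveredByCopies D)) (coveredByCopies⇒homCount≡1 core rigid)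

    cspCount+satCount≤uniqueHomCount+dColCount :
      cspCount D n + satCount D (coveredByCopies D) n ≤ uniqueHomCount D n + dColCount D n
    cspCount+satCount≤uniqueHomCount+dColCount =
      subst₂ (λ s p → cspCount D n + s ≤ uniqueHomCount D n + p)
        (sym (satCount≡sum-satColouringCount (coveredByCopies D) n)) (sym (dColCount≡sum-homCount n))
        (count-pos+sum-≤ (allDigraphs n))

    satCount≤cspCount : satCount D (coveredByCopies D) n ≤ cspCount D n
    satCount≤cspCount =
      subst (_≤ cspCount D n) (sym (satCount≡sum-satColouringCount (coveredByCopies D) n))
        (sum-≤-count-pos (allDigraphs n))

lemma4p15 : (m : ℕ) (D : Digraph m) → IsCore D → IsRigid D →
    (C : DStructure D) → IsCD C →
    ((φ : Sentence m) → (AlmostSure D φ → Sat C φ emptyEnv) × (Sat C φ emptyEnv → AlmostSure D φ)) →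
    TendsToOne (uniqueHomCount D) (cspCount D)
lemma4p15 m D core rigid C isCD almostSure⇔true =
  TendsToOne-transfer
    (cspCount+satCount≤uniqueHomCount+dColCount D core rigid)
    (satCount≤cspCount D core rigid)
    (λ n → length-filter _ (allDColoured D n))
    (proj₂ (almostSure⇔true (coveredByCopies D)) (Sat-coveredByCopies D C (IsCD⇒Covered C isCD)))
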